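{- Let $n,k,l,r$ be integers with $k,r\geq 2$ and $n\geq l\geq t+1$, where $t=t(k,r)$. Let $p,q\geq 0$ be the integers with $n=p(l-1)+q$ and $0\leq q<l-1$, and let $s=s(k,r)$. Then every star-like-$(k,l)$ $r$-uniform hypergraph $H$ on $n$ vertices satisfies \[ |E(H)|\leq \begin{cases} p\binom{l-1}{r}+pk+\binom{q}{r}, & \text{if } l-1>s \text{ and } q>s,\\ p\binom{l-1}{r}+(p-1+q)k, & \text{if } l-1>s \text{ and } q\leq s,\\ \binom{l-1}{r}+(n-l+1)k, & \text{if } l-1\leq s, \end{cases} \] (the right-hand side being the common number of edges of the hypergraphs in $MSH(n;k,l,r)$).
   Context: A hypergraph $H=(V,E)$ has a finite vertex set $V$ and a set $E$ of nonempty subsets of $V$; it is $r$-uniform if every edge has exactly $r$ elements. $K_m^r$ is the complete $r$-uniform hypergraph on $m$ vertices, $K_1$ a single vertex. Binomial coefficients are $0$ when the lower index exceeds the upper. For $k,r\geq2$, $t=t(k,r)$ is the integer with $\binom{t-1}{r-1}\leq k<\binom{t}{r-1}$, and $s=s(k,r)$ is the largest integer with $k+\binom{s}{r}\leq ks$. Star-like-$(k,l)$ $r$-uniform hypergraphs: start with a copy of $K_{l-1}^r$ (the nucleus); attach to it any number of vertex-disjoint satellites, each being either a single vertex $K_1$ or a copy of $K_i^r$ with $r\leq i\leq l-1$, where each satellite is attached by adding exactly $k$ new edges, each an $r$-subset of the union of the satellite's and the nucleus's vertex sets meeting both. $MSH(n;k,l,r)$: with $n=p(l-1)+q$, $0\le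 q<l-1$: if $l-1>s$, nucleus and $p-1$ satellites are $K_{l-1}^r$, plus one satellite $K_q^r$ if $q>s$, or $q$ satellites $K_1$ if $q\le s$; if $l-1\le s$, nucleus $K_{l-1}^r$ with $n-l+1$ satellites $K_1$; each satellite attached by $k$ edges. -}

module Defs where

open import Data.Nat using (ℕ; zero; suc; _+_; _*_; _∸_; _≤_; _<_)
open import Data.Nat.Combinatorics using (_C_)
open import Data.Bool using (Bool; true; false; if_then_else_; _∧_; _∨_)
open import Data.Fin using (Fin; zero; suc; _≟_)
open import Data.Fin.Subset using (Subset; ∣_∣)
open import Data.Vec using (lookup; []; _∷_)
open import Data.List using (List; []; _∷_; [_]; map; _++_; allFin)
open import Data.Bool.ListAction using (all; any)
open import Data.Product using (Σ; _×_; ∃)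
open import Data.Sum using (_⊎_)
open import Relation.Nullary.Decidable using (⌊_⌋)
open import Relation.Binary.PropositionalEquality using (_≡_)

countL : {A : Set} → (A → Bool) → List A → ℕ
countL p [] = 0
countL p (x ∷ xs) = (if p x then 1 else 0) + countL p xs

subsets : (n : ℕ) → List (Subset n)
subsets zero = [ [] ]
subsets (suc n) = map (false ∷_) (subsets n) ++ map (true ∷_) (subsets n)

Hypergraph : ℕ → Set
Hypergraph n = Subset n → Bool

numEdges : {n : ℕ} → Hypergraph n → ℕ
numEdges {n} E = countL E (subsets n)

Uniform : {n : ℕ} → ℕ → Hypergraph n → Set
Uniform r E = ∀ S → E S ≡ true → ∣ S ∣ ≡ r

module _ {n m : ℕ} (lab : Fin n → Fin (suc m)) where
  -- vertex v lies in class j (class 0 = nucleus, class (suc j) = j-th satellite)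
  inClass : Fin (suc m) → Fin n → Bool
  inClass j v = ⌊ lab v ≟ j ⌋

  classSize : Fin (suc m) → ℕ
  classSize j = countL (inClass j) (allFin n)

  within : Fin (suc m) → Subset n → Bool
  within j S = all (λ v → if lookup S v then inClass j v else true) (allFin n)

  meets : Fin (suc m) → Subset n → Bool
  meets j S = any (λ v → lookup S v ∧ inClass j v) (allFin n)

  attaches : Fin m → Subset n → Bool
  attaches j S =
    all (λ v → if lookup S v then (inClass zero v ∨ inClass (suc j) v) else true) (allFin n)
    ∧ meets zero S ∧ meets (suc j) S

-- A star-like-(k,l) r-uniform hypergraph on vertex set Fin n.
-- lab assigns each vertex to the nucleus (0) or to one of m satellites.
record StarLike (n k l r : ℕ) : Set where
  field
    m   : ℕ
    lab : Fin n → Fin (suc m)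
    E   : Hypergraph n
    uniform : Uniform r E
    nucleusSize : classSize lab zero ≡ l ∸ 1
    -- each satellite is K_1 or K_i^r with r ≤ i ≤ l-1
    satelliteSize : ∀ (j : Fin m) →
      classSize lab (suc j) ≡ 1 ⊎ (r ≤ classSize lab (suc j) × classSize lab (suc j) ≤ l ∸ 1)
    complete : ∀ (j : Fin (suc m)) (S : Subset n) → ∣ S ∣ ≡ r → within lab j S ≡ true → E S ≡ true
    edgeShape : ∀ (S : Subset n) → E S ≡ true →
      (∃ λ (j : Fin (suc m)) → within lab j S ≡ true) ⊎ (∃ λ (j : Fin m) → attaches lab j S ≡ true)
    attachCount : ∀ (j : Fin m) → countL (λ S → E S ∧ attaches lab j S) (subsets n) ≡ k

IsT : ℕ → ℕ → ℕ → Set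
IsT k r t = ((t ∸ 1) C (r ∸ 1) ≤ k) × (k < t C (r ∸ 1))

IsS : ℕ → ℕ → ℕ → Set
IsS k r s = (k + s C r ≤ k * s) × (∀ s′ → k + s′ C r ≤ k * s′ → s′ ≤ s)

{-# OPTIONS --safe #-}
-- The edges of a star-like hypergraph lie inside the nucleus, inside a satellite, or among the
-- k edges attaching a satellite, so |E| ≤ C(l-1,r) + Σ (k + C(c,r)) over the satellite orders c,
-- which satisfy 1 ≤ c ≤ l-1 and Σ c = n-l+1. The increments k - C(c,r-1) of c ↦ k c - (k + C(c,r))
-- decrease and its value at c = 1 is 0, so it is nonnegative exactly on [1, s]: when l-1 ≤ s every
-- satellite is beaten by singletons. Otherwise convexity of C(-,r) lets us merge satellites greedily
-- into blocks of order l-1 and a remainder q, which is best spent as q singletons if q ≤ s and as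
-- one K_q^r otherwise.
module Submission where

open import Defs
open import Data.Nat using (ℕ; zero; suc; _+_; _*_; _∸_; _≤_; _<_; _⊔_; _≡ᵇ_; z≤n; s≤s;
  _≤′_; ≤′-refl; ≤′-reflexive; ≤′-step; _≤?_)
open import Data.Nat.Properties hiding (_≟_)
open import Data.Nat.Combinatorics using (_C_; nCk+nC[k+1]≡[n+1]C[k+1])
open import Data.Nat.Tactic.RingSolver using (solve-∀)
open import Data.Bool using (Bool; true; false; if_then_else_; _∧_)
open import Data.Bool.Properties using (∧-zeroʳ; T-≡)
open import Data.Bool.ListAction using (all; and)
open import Data.Fin using (Fin; zero; suc; _≟_)
open import Data.Fin.Subset using (Subset; ∣_∣)
open import Data.Vec using (lookup; _∷_)
open import Data.List using (List; []; _∷_; map; _++_; allFin; length)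
open import Data.List.Properties using (map-tabulate; length-tabulate)
open import Data.Product using (_×_; _,_; ∃₂)
open import Data.Sum using (_⊎_; inj₁; inj₂)
open import Data.Empty using (⊥-elim)
open import Function using (_∘_; id; Equivalence)
open import Relation.Nullary.Decidable using (⌊_⌋; yes; no)
open import Relation.Binary.PropositionalEquality
open import Algebra.Properties.CommutativeSemigroup +-commutativeSemigroup
  using (interchange; x∙yz≈y∙zx; x∙yz≈xz∙y; xy∙z≈xz∙y; xy∙z≈y∙xz)
open import Algebra.Properties.Semiring.Sum +-*-semiring
  using (sum; sum-syntax; ∑-distrib-+; sum-replicate-zero; sum-cong-≗)

-- Binomial coefficients

[1+n]C[1+k]≡nC[1+k]+nCk : ∀ n k → suc n C suc k ≡ n C suc k + n C k
[1+n]C[1+k]≡nC[1+k]+nCk n k = trans (sym (nCk+nC[k+1]≡[n+1]C[k+1] n k)) (+-comm (n C k) (n C suc k))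

nCk≤[1+n]Ck : ∀ n k → n C k ≤ suc n C k
nCk≤[1+n]Ck n zero    = ≤-refl
nCk≤[1+n]Ck n (suc k) rewrite [1+n]C[1+k]≡nC[1+k]+nCk n k = m≤m+n _ _

C-monoˡ-≤ : ∀ k {m n} → m ≤ n → m C k ≤ n C k
C-monoˡ-≤ k {m} {n} m≤n = ≤-trans (C-≤-+ (n ∸ m)) (≤-reflexive (cong (_C k) (m+[n∸m]≡n m≤n)))
  where
  C-≤-+ : ∀ d → m C k ≤ (m + d) C k
  C-≤-+ zero    = ≤-reflexive (cong (_C k) (sym (+-identityʳ m)))
  C-≤-+ (suc d) = ≤-trans (C-≤-+ d)
    (≤-trans (nCk≤[1+n]Ck (m + d) k) (≤-reflexive (cong (_C k) (sym (+-suc m d)))))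

nC[1+k]+m*nCk≤[m+n]C[1+k] : ∀ m n k → n C suc k + m * (n C k) ≤ (m + n) C suc k
nC[1+k]+m*nCk≤[m+n]C[1+k] zero    n k = ≤-reflexive (+-identityʳ _)
nC[1+k]+m*nCk≤[m+n]C[1+k] (suc m) n k = begin
  n C suc k + (n C k + m * (n C k))   ≡⟨ x∙yz≈xz∙y (n C suc k) (n C k) (m * (n C k)) ⟩
  n C suc k + m * (n C k) + n C k     ≤⟨ +-mono-≤ (nC[1+k]+m*nCk≤[m+n]C[1+k] m n k) (C-monoˡ-≤ k (m≤n+m n m)) ⟩
  (m + n) C suc k + (m + n) C k       ≡⟨ [1+n]C[1+k]≡nC[1+k]+nCk (m + n) k ⟨
  (suc m + n) C suc k                 ∎
  where open ≤-Reasoning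

mC[2+k]+[1+n]C[2+k]+mC[1+k]≤[m+1+n]C[2+k] : ∀ m n k →
  m C suc (suc k) + suc n C suc (suc k) + m C suc k ≤ (m + suc n) C suc (suc k)
mC[2+k]+[1+n]C[2+k]+mC[1+k]≤[m+1+n]C[2+k] m zero k = ≤-reflexive (begin
  m C suc (suc k) + 0 + m C suc k   ≡⟨ cong (_+ m C suc k) (+-identityʳ _) ⟩
  m C suc (suc k) + m C suc k       ≡⟨ [1+n]C[1+k]≡nC[1+k]+nCk m (suc k) ⟨
  suc m C suc (suc k)               ≡⟨ cong (_C suc (suc k)) (+-comm 1 m) ⟩
  (m + 1) C suc (suc k)             ∎)
  where open ≡-Reasoning
mC[2+k]+[1+n]C[2+k]+mC[1+k]≤[m+1+n]C[2+k] m (suc n) k = begin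
  m C r + suc (suc n) C r + m C suc k
    ≡⟨ cong (λ z → m C r + z + m C suc k) ([1+n]C[1+k]≡nC[1+k]+nCk (suc n) (suc k)) ⟩
  m C r + (suc n C r + suc n C suc k) + m C suc k
    ≡⟨ reorder (m C r) (suc n C r) (suc n C suc k) (m C suc k) ⟩
  m C r + suc n C r + m C suc k + suc n C suc k
    ≤⟨ +-mono-≤ (mC[2+k]+[1+n]C[2+k]+mC[1+k]≤[m+1+n]C[2+k] m n k) (C-monoˡ-≤ (suc k) (m≤n+m (suc n) m)) ⟩
  (m + suc n) C r + (m + suc n) C suc k
    ≡⟨ [1+n]C[1+k]≡nC[1+k]+nCk (m + suc n) (suc k) ⟨
  suc (m + suc n) C r
    ≡⟨ cong (_C r) (+-suc m (suc n)) ⟨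
  (m + suc (suc n)) C r ∎
  where
  open ≤-Reasoning
  r : ℕ
  r = suc (suc k)
  reorder : ∀ a b c d → a + (b + c) + d ≡ a + b + d + c
  reorder = solve-∀

[m+x]Ck+nCk≤[n+x]Ck+mCk : ∀ {m n} → m ≤ n → ∀ x k → (m + x) C k + n C k ≤ (n + x) C k + m C k
[m+x]Ck+nCk≤[n+x]Ck+mCk m≤n x zero = ≤-refl
[m+x]Ck+nCk≤[n+x]Ck+mCk {m} {n} m≤n zero (suc k)
  rewrite +-identityʳ m | +-identityʳ n = ≤-reflexive (+-comm (m C suc k) (n C suc k))
[m+x]Ck+nCk≤[n+x]Ck+mCk {m} {n} m≤n (suc x) (suc k) = begin
  (m + suc x) C suc k + n C suc k               ≡⟨ cong (λ z → z C suc k + n C suc k) (+-suc m x) ⟩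
  suc (m + x) C suc k + n C suc k               ≡⟨ cong (_+ n C suc k) ([1+n]C[1+k]≡nC[1+k]+nCk (m + x) k) ⟩
  (m + x) C suc k + (m + x) C k + n C suc k     ≡⟨ xy∙z≈xz∙y ((m + x) C suc k) ((m + x) C k) (n C suc k) ⟩
  (m + x) C suc k + n C suc k + (m + x) C k     ≤⟨ +-mono-≤ ([m+x]Ck+nCk≤[n+x]Ck+mCk m≤n x (suc k))
                                                            (C-monoˡ-≤ k (+-monoˡ-≤ x m≤n)) ⟩
  (n + x) C suc k + m C suc k + (n + x) C k     ≡⟨ xy∙z≈xz∙y ((n + x) C suc k) (m C suc k) ((n + x) C k) ⟩
  (n + x) C suc k + (n + x) C k + m C suc k     ≡⟨ cong (_+ m C suc k) ([1+n]C[1+k]≡nC[1+k]+nCk (n + x) k) ⟨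
  suc (n + x) C suc k + m C suc k               ≡⟨ cong (λ z → z C suc k + m C suc k) (+-suc n x) ⟨
  (n + suc x) C suc k + m C suc k               ∎
  where open ≤-Reasoning

-- Counting

indicator : Bool → ℕ
indicator b = if b then 1 else 0

≤-∑ : ∀ {m} (f : Fin m → ℕ) i → f i ≤ sum f
≤-∑ f zero    = m≤m+n _ _
≤-∑ f (suc i) = ≤-trans (≤-∑ (f ∘ suc) i) (m≤n+m _ _)

∑-mono-≤ : ∀ {m} {f g : Fin m → ℕ} → (∀ i → f i ≤ g i) → sum f ≤ sum g
∑-mono-≤ {zero}  _   = z≤n
∑-mono-≤ {suc m} f≤g = +-mono-≤ (f≤g zero) (∑-mono-≤ (f≤g ∘ suc))

1≤∑indicator : ∀ {m} (f : Fin m → Bool) i → f i ≡ true → 1 ≤ ∑[ j < m ] indicator (f j)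
1≤∑indicator {m} f i fi≡true = subst (λ b → indicator b ≤ ∑[ j < m ] indicator (f j)) fi≡true (≤-∑ (indicator ∘ f) i)

∑indicator-≟ : ∀ {m} (x : Fin m) → ∑[ j < m ] indicator ⌊ x ≟ j ⌋ ≡ 1
∑indicator-≟ {suc m} zero    = cong suc (sum-replicate-zero m)
∑indicator-≟ {suc m} (suc x) = trans (sum-cong-≗ (cong indicator ∘ ⌊suc≟suc⌋ x)) (∑indicator-≟ x)
  where
  ⌊suc≟suc⌋ : ∀ {m} (x j : Fin m) → ⌊ suc x ≟ suc j ⌋ ≡ ⌊ x ≟ j ⌋
  ⌊suc≟suc⌋ x j with x ≟ j
  ... | yes _ = refl
  ... | no  _ = refl

module _ {A : Set} where

  countL-++ : ∀ (p : A → Bool) xs ys → countL p (xs ++ ys) ≡ countL p xs + countL p ys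
  countL-++ p []       ys = refl
  countL-++ p (x ∷ xs) ys =
    trans (cong (indicator (p x) +_) (countL-++ p xs ys)) (sym (+-assoc (indicator (p x)) _ _))

  countL-map : ∀ {B : Set} (p : B → Bool) (f : A → B) xs → countL p (map f xs) ≡ countL (p ∘ f) xs
  countL-map p f []       = refl
  countL-map p f (x ∷ xs) = cong (indicator (p (f x)) +_) (countL-map p f xs)

  countL-cong : ∀ {p q : A → Bool} → (∀ x → p x ≡ q x) → ∀ xs → countL p xs ≡ countL q xs
  countL-cong p≗q []       = refl
  countL-cong p≗q (x ∷ xs) = cong₂ (λ b c → indicator b + c) (p≗q x) (countL-cong p≗q xs)

  countL-mono : ∀ {p q : A → Bool} → (∀ x → indicator (p x) ≤ indicator (q x)) →
                ∀ xs → countL p xs ≤ countL q xs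
  countL-mono p≤q []       = z≤n
  countL-mono p≤q (x ∷ xs) = +-mono-≤ (p≤q x) (countL-mono p≤q xs)

  countL-false : ∀ {p : A → Bool} → (∀ x → p x ≡ false) → ∀ xs → countL p xs ≡ 0
  countL-false p≡false []       = refl
  countL-false p≡false (x ∷ xs) rewrite p≡false x = countL-false p≡false xs

  countL-≤-∑+∑ : ∀ {m₁ m₂} (p : A → Bool) (q₁ : Fin m₁ → A → Bool) (q₂ : Fin m₂ → A → Bool) →
    (∀ x → indicator (p x) ≤ ∑[ i < m₁ ] indicator (q₁ i x) + ∑[ i < m₂ ] indicator (q₂ i x)) →
    ∀ xs → countL p xs ≤ ∑[ i < m₁ ] countL (q₁ i) xs + ∑[ i < m₂ ] countL (q₂ i) xs
  countL-≤-∑+∑ {m₁} {m₂} p q₁ q₂ _ [] =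
    ≤-reflexive (sym (cong₂ _+_ (sum-replicate-zero m₁) (sum-replicate-zero m₂)))
  countL-≤-∑+∑ {m₁} {m₂} p q₁ q₂ p≤q (x ∷ xs) = begin
    indicator (p x) + countL p xs
      ≤⟨ +-mono-≤ (p≤q x) (countL-≤-∑+∑ p q₁ q₂ p≤q xs) ⟩
    (sum (at₁ x) + sum (at₂ x)) + (sum (in₁ xs) + sum (in₂ xs))
      ≡⟨ interchange (sum (at₁ x)) (sum (at₂ x)) (sum (in₁ xs)) (sum (in₂ xs)) ⟩
    (sum (at₁ x) + sum (in₁ xs)) + (sum (at₂ x) + sum (in₂ xs))
      ≡⟨ cong₂ _+_ (∑-distrib-+ (at₁ x) (in₁ xs)) (∑-distrib-+ (at₂ x) (in₂ xs)) ⟨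
    sum (in₁ (x ∷ xs)) + sum (in₂ (x ∷ xs)) ∎
    where
    open ≤-Reasoning
    at₁ : A → Fin m₁ → ℕ
    at₁ y i = indicator (q₁ i y)
    at₂ : A → Fin m₂ → ℕ
    at₂ y i = indicator (q₂ i y)
    in₁ : List A → Fin m₁ → ℕ
    in₁ ys i = countL (q₁ i) ys
    in₂ : List A → Fin m₂ → ℕ
    in₂ ys i = countL (q₂ i) ys

  ∑countL≡length : ∀ {m} (q : Fin m → A → Bool) → (∀ x → ∑[ i < m ] indicator (q i x) ≡ 1) →
                   ∀ xs → ∑[ i < m ] countL (q i) xs ≡ length xs
  ∑countL≡length {m} q _ [] = sum-replicate-zero m
  ∑countL≡length q one (x ∷ xs) =
    trans (∑-distrib-+ (λ i → indicator (q i x)) (λ i → countL (q i) xs))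
          (cong₂ _+_ (one x) (∑countL≡length q one xs))

-- within lab j S of Defs is S ⊆ᵇ inClass lab j.
_⊆ᵇ_ : ∀ {n} → Subset n → (Fin n → Bool) → Bool
S ⊆ᵇ a = all (λ v → if lookup S v then a v else true) (allFin _)

∷-⊆ᵇ : ∀ {n} b (S : Subset n) a → (b ∷ S) ⊆ᵇ a ≡ (if b then a zero else true) ∧ S ⊆ᵇ (a ∘ suc)
∷-⊆ᵇ b S a = cong (_ ∧_) (trans (cong and (map-tabulate suc a?)) (sym (cong and (map-tabulate id (a? ∘ suc)))))
  where
  a? : Fin _ → Bool
  a? v = if lookup (b ∷ S) v then a v else true

countL-allFin-suc : ∀ {n} (a : Fin (suc n) → Bool) →
  countL a (allFin (suc n)) ≡ indicator (a zero) + countL (a ∘ suc) (allFin n)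
countL-allFin-suc {n} a = cong (indicator (a zero) +_)
  (trans (cong (countL a) (sym (map-tabulate id suc))) (countL-map a suc (allFin n)))

countL-⊆ᵇ≡C : ∀ n (a : Fin n → Bool) r →
  countL (λ S → (∣ S ∣ ≡ᵇ r) ∧ S ⊆ᵇ a) (subsets n) ≡ countL a (allFin n) C r
countL-⊆ᵇ≡C zero    a zero    = refl
countL-⊆ᵇ≡C zero    a (suc r) = refl
countL-⊆ᵇ≡C (suc n) a r = begin
  countL P (map (false ∷_) (subsets n) ++ map (true ∷_) (subsets n))
    ≡⟨ countL-++ P (map (false ∷_) (subsets n)) (map (true ∷_) (subsets n)) ⟩
  countL P (map (false ∷_) (subsets n)) + countL P (map (true ∷_) (subsets n))
    ≡⟨ cong₂ _+_ (countL-map P (false ∷_) (subsets n)) (countL-map P (true ∷_) (subsets n)) ⟩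
  countL (P ∘ (false ∷_)) (subsets n) + countL (P ∘ (true ∷_)) (subsets n)
    ≡⟨ cong₂ _+_ (countL-cong (λ S → cong ((∣ S ∣ ≡ᵇ r) ∧_) (∷-⊆ᵇ false S a)) (subsets n))
                 (countL-cong (λ S → cong ((suc ∣ S ∣ ≡ᵇ r) ∧_) (∷-⊆ᵇ true S a)) (subsets n)) ⟩
  without r + with′ (a zero) r
    ≡⟨ split (a zero) r ⟩
  (indicator (a zero) + countL (a ∘ suc) (allFin n)) C r
    ≡⟨ cong (_C r) (countL-allFin-suc a) ⟨
  countL a (allFin (suc n)) C r ∎
  where
  open ≡-Reasoning
  P : Subset (suc n) → Bool
  P S = (∣ S ∣ ≡ᵇ r) ∧ S ⊆ᵇ a
  without : ℕ → ℕ
  without r′ = countL (λ S → (∣ S ∣ ≡ᵇ r′) ∧ S ⊆ᵇ (a ∘ suc)) (subsets n)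
  with′ : Bool → ℕ → ℕ
  with′ b r′ = countL (λ S → (suc ∣ S ∣ ≡ᵇ r′) ∧ (b ∧ S ⊆ᵇ (a ∘ suc))) (subsets n)
  split : ∀ b r′ → without r′ + with′ b r′ ≡ (indicator b + countL (a ∘ suc) (allFin n)) C r′
  split false r′ = trans (cong₂ _+_ (countL-⊆ᵇ≡C n (a ∘ suc) r′) (countL-false (λ S → ∧-zeroʳ _) (subsets n)))
                         (+-identityʳ _)
  split true zero = trans (cong₂ _+_ (countL-⊆ᵇ≡C n (a ∘ suc) zero) (countL-false (λ _ → refl) (subsets n)))
                          (+-identityʳ _)
  split true (suc r′) = trans (cong₂ _+_ (countL-⊆ᵇ≡C n (a ∘ suc) (suc r′)) (countL-⊆ᵇ≡C n (a ∘ suc) r′))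
                              (sym ([1+n]C[1+k]≡nC[1+k]+nCk (countL (a ∘ suc) (allFin n)) r′))

-- Star-like hypergraphs

module StarLikeProperties {n k l r : ℕ} (H : StarLike n k l r) where
  open StarLike H

  order : Fin m → ℕ
  order j = classSize lab (suc j)

  nucleus+∑order≡n : l ∸ 1 + sum order ≡ n
  nucleus+∑order≡n = begin
    l ∸ 1 + sum order                ≡⟨ cong (_+ sum order) nucleusSize ⟨
    ∑[ j < suc m ] classSize lab j   ≡⟨ ∑countL≡length (inClass lab) (∑indicator-≟ ∘ lab) (allFin n) ⟩
    length (allFin n)                ≡⟨ length-tabulate id ⟩
    n                                ∎
    where open ≡-Reasoning

  1≤order : 1 ≤ r → ∀ j → 1 ≤ order j
  1≤order 1≤r j with satelliteSize j
  ... | inj₁ order≡1       = ≤-reflexive (sym order≡1)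
  ... | inj₂ (r≤order , _) = ≤-trans 1≤r r≤order

  order≤nucleus : 1 ≤ l ∸ 1 → ∀ j → order j ≤ l ∸ 1
  order≤nucleus 1≤nucleus j with satelliteSize j
  ... | inj₁ order≡1             = ≤-trans (≤-reflexive order≡1) 1≤nucleus
  ... | inj₂ (_ , order≤nucleus) = order≤nucleus

  n≡p*[l∸1]+q⇒1≤p : ∀ {p q} → n ≡ p * (l ∸ 1) + q → q < l ∸ 1 → 1 ≤ p
  n≡p*[l∸1]+q⇒1≤p {zero}  n≡q q<l∸1 =
    ⊥-elim (<⇒≱ q<l∸1 (≤-trans (m≤m+n (l ∸ 1) (sum order)) (≤-reflexive (trans nucleus+∑order≡n n≡q))))
  n≡p*[l∸1]+q⇒1≤p {suc _} _ _ = s≤s z≤n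

  ∑order≡[p∸1]*[l∸1]+q : ∀ {p q} → n ≡ p * (l ∸ 1) + q → q < l ∸ 1 → sum order ≡ (p ∸ 1) * (l ∸ 1) + q
  ∑order≡[p∸1]*[l∸1]+q {zero}      n≡q     q<l∸1 = ⊥-elim (1+n≰n (n≡p*[l∸1]+q⇒1≤p n≡q q<l∸1))
  ∑order≡[p∸1]*[l∸1]+q {suc p} {q} n≡p*l+q _ = +-cancelˡ-≡ (l ∸ 1) (sum order) (p * (l ∸ 1) + q)
    (trans nucleus+∑order≡n (trans n≡p*l+q (+-assoc (l ∸ 1) (p * (l ∸ 1)) q)))

  ∑order≡n∸l+1 : 1 ≤ l → l ≤ n → sum order ≡ n ∸ l + 1
  ∑order≡n∸l+1 1≤l l≤n = sym (begin
    n ∸ l + 1                                ≡⟨ +-∸-comm 1 l≤n ⟨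
    (n + 1) ∸ l                              ≡⟨ cong₂ (λ x y → (x + 1) ∸ y) nucleus+∑order≡n (m∸n+n≡m 1≤l) ⟨
    (l ∸ 1 + sum order + 1) ∸ (l ∸ 1 + 1)    ≡⟨ cong (_∸ (l ∸ 1 + 1)) (+-assoc (l ∸ 1) (sum order) 1) ⟩
    (l ∸ 1 + (sum order + 1)) ∸ (l ∸ 1 + 1)  ≡⟨ [m+n]∸[m+o]≡n∸o (l ∸ 1) (sum order + 1) 1 ⟩
    (sum order + 1) ∸ 1                      ≡⟨ m+n∸n≡m (sum order) 1 ⟩
    sum order                                ∎)
    where open ≡-Reasoning

  edge-indicator≤ : ∀ S → indicator (E S) ≤ ∑[ j < suc m ] indicator (E S ∧ within lab j S)
                                          + ∑[ j < m ] indicator (E S ∧ attaches lab j S)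
  edge-indicator≤ S with E S in eq
  ... | false = z≤n
  ... | true with edgeShape S eq
  ...   | inj₁ (j , w) = ≤-trans (1≤∑indicator (λ i → within lab i S) j w) (m≤m+n _ _)
  ...   | inj₂ (j , w) = ≤-trans (1≤∑indicator (λ i → attaches lab i S) j w) (m≤n+m _ _)

  #edges-within≤ : ∀ j → countL (λ S → E S ∧ within lab j S) (subsets n) ≤ classSize lab j C r
  #edges-within≤ j = ≤-trans (countL-mono edge⇒size-r (subsets n)) (≤-reflexive (countL-⊆ᵇ≡C n (inClass lab j) r))
    where
    edge⇒size-r : ∀ S → indicator (E S ∧ within lab j S) ≤ indicator ((∣ S ∣ ≡ᵇ r) ∧ within lab j S)
    edge⇒size-r S with E S in eq
    ... | false = z≤n
    ... | true rewrite uniform S eq | Equivalence.to T-≡ (≡⇒≡ᵇ r r refl) = ≤-refl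

  numEdges≤ : numEdges E ≤ (l ∸ 1) C r + ∑[ j < m ] (k + order j C r)
  numEdges≤ = begin
    numEdges E
      ≤⟨ countL-≤-∑+∑ E (λ j S → E S ∧ within lab j S) (λ j S → E S ∧ attaches lab j S) edge-indicator≤ (subsets n) ⟩
    ∑[ j < suc m ] (countL (λ S → E S ∧ within lab j S) (subsets n))
      + ∑[ j < m ] (countL (λ S → E S ∧ attaches lab j S) (subsets n))
      ≤⟨ +-mono-≤ (∑-mono-≤ #edges-within≤) (≤-reflexive (sum-cong-≗ attachCount)) ⟩
    ∑[ j < suc m ] (classSize lab j C r) + ∑[ j < m ] k
      ≡⟨ cong (λ x → x C r + ∑[ j < m ] (order j C r) + ∑[ j < m ] k) nucleusSize ⟩
    (l ∸ 1) C r + ∑[ j < m ] (order j C r) + ∑[ j < m ] k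
      ≡⟨ x∙yz≈xz∙y ((l ∸ 1) C r) (∑[ j < m ] k) (∑[ j < m ] (order j C r)) ⟨
    (l ∸ 1) C r + (∑[ j < m ] k + ∑[ j < m ] (order j C r))
      ≡⟨ cong ((l ∸ 1) C r +_) (∑-distrib-+ (λ _ → k) (λ j → order j C r)) ⟨
    (l ∸ 1) C r + ∑[ j < m ] (k + order j C r) ∎
    where open ≤-Reasoning

-- Optimising the satellite orders

-- A satellite of order c, attached by its k edges, carries satellite c edges (for c = 1 this is
-- K_1, as 1 C r = 0), while c singleton satellites carry k * c; s(k,r) is the largest c with
-- LinearWins c. The remainder q of MSH is spent in the better of these two ways.
module Satellites (k j : ℕ) where

  private
    r : ℕ
    r = suc (suc j)

  satellite : ℕ → ℕ
  satellite c = k + c C r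

  LinearWins : ℕ → Set
  LinearWins c = satellite c ≤ k * c

  remainder : ℕ → ℕ
  remainder zero    = 0
  remainder (suc x) = k * suc x ⊔ satellite (suc x)

  linearWins-suc : ∀ c → c C suc j ≤ k → LinearWins (suc c)
  linearWins-suc zero    _ = ≤-reflexive (trans (+-identityʳ k) (sym (*-identityʳ k)))
  linearWins-suc (suc c) h = begin
    k + suc (suc c) C r              ≡⟨ cong (k +_) ([1+n]C[1+k]≡nC[1+k]+nCk (suc c) (suc j)) ⟩
    k + (suc c C r + suc c C suc j)  ≡⟨ +-assoc k _ _ ⟨
    k + suc c C r + suc c C suc j    ≤⟨ +-mono-≤ (linearWins-suc c (≤-trans (nCk≤[1+n]Ck c (suc j)) h)) h ⟩
    k * suc c + k                    ≡⟨ +-comm (k * suc c) k ⟩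
    k + k * suc c                    ≡⟨ *-suc k (suc c) ⟨
    k * suc (suc c)                  ∎
    where open ≤-Reasoning

  large⊎linearWins : ∀ c → k ≤ suc c C suc j ⊎ LinearWins (suc c)
  large⊎linearWins c with k ≤? suc c C suc j
  ... | yes k≤ = inj₁ k≤
  ... | no  k≰ = inj₂ (linearWins-suc c (≤-trans (nCk≤[1+n]Ck c (suc j)) (<⇒≤ (≰⇒> k≰))))

  linearWins-pred : ∀ c → LinearWins (suc (suc c)) → LinearWins (suc c)
  linearWins-pred c wins with large⊎linearWins c
  ... | inj₂ wins′ = wins′
  ... | inj₁ k≤    = begin
    k + suc c C r                    ≤⟨ +-monoˡ-≤ (suc c C r) k≤ ⟩
    suc c C suc j + suc c C r        ≡⟨ +-comm (suc c C suc j) _ ⟩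
    suc c C r + suc c C suc j        ≤⟨ +-cancelˡ-≤ k _ _ wins+ ⟩
    k * suc c                        ∎
    where
    open ≤-Reasoning
    wins+ : k + (suc c C r + suc c C suc j) ≤ k + k * suc c
    wins+ = subst₂ _≤_ (cong (k +_) ([1+n]C[1+k]≡nC[1+k]+nCk (suc c) (suc j))) (*-suc k (suc c)) wins

  linearWins-≤′ : ∀ {c s} → 1 ≤ c → c ≤′ s → LinearWins s → LinearWins c
  linearWins-≤′ _ ≤′-refl wins = wins
  linearWins-≤′ {s = suc (suc s)} 1≤c (≤′-step c≤s) wins = linearWins-≤′ 1≤c c≤s (linearWins-pred s wins)
  linearWins-≤′ {s = suc zero} (s≤s z≤n) (≤′-step (≤′-reflexive ()))

  k*≤satellite-beyond : ∀ {s x} → (∀ y → LinearWins y → y ≤ s) → s < x → k * x ≤ satellite x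
  k*≤satellite-beyond {s} {x} maximal s<x with satellite x ≤? k * x
  ... | yes wins  = ⊥-elim (<⇒≱ s<x (maximal x wins))
  ... | no  ¬wins = <⇒≤ (≰⇒> ¬wins)

  ∑satellite≤k*sum : ∀ {m s} (cs : Fin m → ℕ) → (∀ i → 1 ≤ cs i) → (∀ i → cs i ≤ s) → LinearWins s →
                     ∑[ i < m ] satellite (cs i) ≤ k * sum cs
  ∑satellite≤k*sum {zero}  _  _    _    _    = z≤n
  ∑satellite≤k*sum {suc m} cs 1≤cs cs≤s wins = begin
    satellite (cs zero) + ∑[ i < m ] satellite (cs (suc i))
      ≤⟨ +-mono-≤ (linearWins-≤′ (1≤cs zero) (≤⇒≤′ (cs≤s zero)) wins)
                  (∑satellite≤k*sum (cs ∘ suc) (1≤cs ∘ suc) (cs≤s ∘ suc) wins) ⟩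
    k * cs zero + k * sum (cs ∘ suc)
      ≡⟨ *-distribˡ-+ k (cs zero) _ ⟨
    k * sum cs ∎
    where open ≤-Reasoning

  k*≤remainder : ∀ x → k * x ≤ remainder x
  k*≤remainder zero    = ≤-reflexive (*-zeroʳ k)
  k*≤remainder (suc x) = m≤m⊔n _ _

  satellite≤remainder : ∀ x → 1 ≤ x → satellite x ≤ remainder x
  satellite≤remainder (suc x) _ = m≤n⊔m _ _

  remainder-lub : ∀ x {z} → k * x ≤ z → (1 ≤ x → satellite x ≤ z) → remainder x ≤ z
  remainder-lub zero    _  _  = z≤n
  remainder-lub (suc x) h₁ h₂ = ⊔-lub h₁ (h₂ (s≤s z≤n))

  remainder+-lub : ∀ x {y z} → k * x + y ≤ z → (1 ≤ x → satellite x + y ≤ z) → remainder x + y ≤ z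
  remainder+-lub zero    {y} {z} h₁ _  = subst (λ w → w + y ≤ z) (*-zeroʳ k) h₁
  remainder+-lub (suc x) {y} {z} h₁ h₂ =
    subst (_≤ z) (sym (+-distribʳ-⊔ y (k * suc x) (satellite (suc x)))) (⊔-lub h₁ (h₂ (s≤s z≤n)))

  k*m+satellite≤remainder : ∀ m c → 1 ≤ c → k * m + satellite c ≤ remainder (m + c)
  k*m+satellite≤remainder m (suc c) _ with large⊎linearWins c
  ... | inj₁ k≤ = ≤-trans (begin
      k * m + (k + suc c C r)                 ≡⟨ x∙yz≈y∙zx (k * m) k (suc c C r) ⟩
      k + (suc c C r + k * m)                 ≤⟨ +-monoʳ-≤ k (+-monoʳ-≤ (suc c C r)
                                                   (subst (_≤ m * (suc c C suc j)) (*-comm m k) (*-monoʳ-≤ m k≤))) ⟩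
      k + (suc c C r + m * (suc c C suc j))   ≤⟨ +-monoʳ-≤ k (nC[1+k]+m*nCk≤[m+n]C[1+k] m (suc c) (suc j)) ⟩
      satellite (m + suc c)                   ∎)
    (satellite≤remainder (m + suc c) (≤-trans (s≤s z≤n) (m≤n+m (suc c) m)))
    where open ≤-Reasoning
  ... | inj₂ wins = begin
    k * m + satellite (suc c)                 ≤⟨ +-monoʳ-≤ (k * m) wins ⟩
    k * m + k * suc c                         ≡⟨ *-distribˡ-+ k m (suc c) ⟨
    k * (m + suc c)                           ≤⟨ k*≤remainder (m + suc c) ⟩
    remainder (m + suc c)                     ∎
    where open ≤-Reasoning

  satellite+satellite≤remainder : ∀ a c → 1 ≤ a → 1 ≤ c → satellite a + satellite c ≤ remainder (a + c)
  satellite+satellite≤remainder (suc a) (suc c) _ _ with large⊎linearWins a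
  ... | inj₁ k≤ = ≤-trans (begin
      k + suc a C r + (k + suc c C r)               ≡⟨ reorder k (suc a C r) (suc c C r) ⟩
      k + (suc a C r + suc c C r + k)               ≤⟨ +-monoʳ-≤ k (+-monoʳ-≤ (suc a C r + suc c C r) k≤) ⟩
      k + (suc a C r + suc c C r + suc a C suc j)   ≤⟨ +-monoʳ-≤ k
                                                         (mC[2+k]+[1+n]C[2+k]+mC[1+k]≤[m+1+n]C[2+k] (suc a) c j) ⟩
      satellite (suc a + suc c)                     ∎)
    (satellite≤remainder (suc a + suc c) (s≤s z≤n))
    where
    open ≤-Reasoning
    reorder : ∀ x y z → x + y + (x + z) ≡ x + (y + z + x)
    reorder = solve-∀
  ... | inj₂ wins = ≤-trans (+-monoˡ-≤ (satellite (suc c)) wins) (k*m+satellite≤remainder (suc a) (suc c) (s≤s z≤n))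

  remainder+satellite≤remainder : ∀ a c → 1 ≤ c → remainder a + satellite c ≤ remainder (a + c)
  remainder+satellite≤remainder a c 1≤c =
    remainder+-lub a (k*m+satellite≤remainder a c 1≤c) (λ 1≤a → satellite+satellite≤remainder a c 1≤a 1≤c)

  module _ {L : ℕ} (k*L≤satellite : k * L ≤ satellite L) where

    remainder≤satellite : remainder L ≤ satellite L
    remainder≤satellite = remainder-lub L k*L≤satellite (λ _ → ≤-refl)

    satellite+satellite≤satellite+remainder : ∀ b c q → b + c ≡ L + q → q < c → c ≤ L → 1 ≤ b →
      satellite b + satellite c ≤ satellite L + remainder q
    satellite+satellite≤satellite+remainder b c zero b+c≡L q<c _ 1≤b = begin
      satellite b + satellite c          ≤⟨ satellite+satellite≤remainder b c 1≤b (≤-trans (s≤s z≤n) q<c) ⟩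
      remainder (b + c)                  ≡⟨ cong remainder (trans b+c≡L (+-identityʳ L)) ⟩
      remainder L                        ≤⟨ remainder≤satellite ⟩
      satellite L                        ≡⟨ +-identityʳ _ ⟨
      satellite L + 0                    ∎
      where open ≤-Reasoning
    satellite+satellite≤satellite+remainder b c q@(suc _) b+c≡L+q q<c c≤L _ = begin
      (k + b C r) + (k + c C r)          ≡⟨ cong (λ y → (k + y C r) + (k + c C r)) b≡q+x ⟩
      (k + (q + x) C r) + (k + c C r)    ≡⟨ interchange k ((q + x) C r) k (c C r) ⟩
      (k + k) + ((q + x) C r + c C r)    ≤⟨ +-monoʳ-≤ (k + k) ([m+x]Ck+nCk≤[n+x]Ck+mCk (<⇒≤ q<c) x r) ⟩
      (k + k) + ((c + x) C r + q C r)    ≡⟨ cong (λ y → (k + k) + (y C r + q C r)) c+x≡L ⟩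
      (k + k) + (L C r + q C r)          ≡⟨ interchange k k (L C r) (q C r) ⟩
      satellite L + satellite q          ≤⟨ +-monoʳ-≤ (satellite L) (satellite≤remainder q (s≤s z≤n)) ⟩
      satellite L + remainder q          ∎
      where
      open ≤-Reasoning
      q≤b : q ≤ b
      q≤b = +-cancelʳ-≤ c q b (begin
        q + c  ≤⟨ +-monoʳ-≤ q c≤L ⟩
        q + L  ≡⟨ +-comm q L ⟩
        L + q  ≡⟨ b+c≡L+q ⟨
        b + c  ∎)
      x : ℕ
      x = b ∸ q
      b≡q+x : b ≡ q + x
      b≡q+x = sym (m+[n∸m]≡n q≤b)
      c+x≡L : c + x ≡ L
      c+x≡L = +-cancelʳ-≡ q (c + x) L (begin-equality
        c + x + q    ≡⟨ +-assoc c x q ⟩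
        c + (x + q)  ≡⟨ cong (c +_) (trans (+-comm x q) (sym b≡q+x)) ⟩
        c + b        ≡⟨ +-comm c b ⟩
        b + c        ≡⟨ b+c≡L+q ⟩
        L + q        ∎)

    remainder+satellite≤satellite+remainder : ∀ b c q → b + c ≡ L + q → q < c → c ≤ L →
      remainder b + satellite c ≤ satellite L + remainder q
    remainder+satellite≤satellite+remainder b c q b+c≡L+q q<c c≤L =
      remainder+-lub b linear (satellite+satellite≤satellite+remainder b c q b+c≡L+q q<c c≤L)
      where
      open ≤-Reasoning
      a : ℕ
      a = L ∸ c
      a+c≡L : a + c ≡ L
      a+c≡L = m∸n+n≡m c≤L
      b≡a+q : b ≡ a + q
      b≡a+q = +-cancelʳ-≡ c b (a + q) (begin-equality
        b + c      ≡⟨ b+c≡L+q ⟩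
        L + q      ≡⟨ cong (_+ q) a+c≡L ⟨
        a + c + q  ≡⟨ xy∙z≈xz∙y a c q ⟩
        a + q + c  ∎)
      linear : k * b + satellite c ≤ satellite L + remainder q
      linear = begin
        k * b + satellite c              ≡⟨ cong (λ y → k * y + satellite c) b≡a+q ⟩
        k * (a + q) + satellite c        ≡⟨ cong (_+ satellite c) (*-distribˡ-+ k a q) ⟩
        k * a + k * q + satellite c      ≡⟨ xy∙z≈xz∙y (k * a) (k * q) (satellite c) ⟩
        k * a + satellite c + k * q      ≤⟨ +-mono-≤ (k*m+satellite≤remainder a c (≤-trans (s≤s z≤n) q<c))
                                                      (k*≤remainder q) ⟩
        remainder (a + c) + remainder q  ≡⟨ cong (λ y → remainder y + remainder q) a+c≡L ⟩
        remainder L + remainder q        ≤⟨ +-monoˡ-≤ (remainder q) remainder≤satellite ⟩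
        satellite L + remainder q        ∎

    -- One more satellite of order c either merges into the remainder (c ≤ q) or, together with
    -- the remainder, completes a block of order L and leaves the remainder L + q - c.
    absorb : ∀ c R P q → 1 ≤ c → c ≤ L → c + R ≡ P * L + q → q < L →
      ∃₂ λ P′ q′ → R ≡ P′ * L + q′ × q′ < L ×
                   satellite c + (P′ * satellite L + remainder q′) ≤ P * satellite L + remainder q
    absorb c R P q 1≤c c≤L eq q<L with c ≤? q
    ... | yes c≤q = P , q ∸ c , R≡ , ≤-<-trans (m∸n≤m q c) q<L , bound
      where
      open ≤-Reasoning
      R≡ : R ≡ P * L + (q ∸ c)
      R≡ = +-cancelʳ-≡ c R _ (begin-equality
        R + c                ≡⟨ +-comm R c ⟩
        c + R                ≡⟨ eq ⟩
        P * L + q            ≡⟨ cong (P * L +_) (m∸n+n≡m c≤q) ⟨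
        P * L + (q ∸ c + c)  ≡⟨ +-assoc (P * L) (q ∸ c) c ⟨
        P * L + (q ∸ c) + c  ∎)
      bound : satellite c + (P * satellite L + remainder (q ∸ c)) ≤ P * satellite L + remainder q
      bound = begin
        satellite c + (P * satellite L + remainder (q ∸ c))  ≡⟨ x∙yz≈y∙zx (satellite c) (P * satellite L) _ ⟩
        P * satellite L + (remainder (q ∸ c) + satellite c)  ≤⟨ +-monoʳ-≤ (P * satellite L)
                                                                   (remainder+satellite≤remainder (q ∸ c) c 1≤c) ⟩
        P * satellite L + remainder (q ∸ c + c)              ≡⟨ cong (λ y → P * satellite L + remainder y) (m∸n+n≡m c≤q) ⟩
        P * satellite L + remainder q                        ∎
    absorb c R zero    q _   _   eq _   | no c≰q = ⊥-elim (c≰q (≤-trans (m≤m+n c R) (≤-reflexive eq)))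
    absorb c R (suc P) q 1≤c c≤L eq q<L | no c≰q = P , q′ , R≡ , q′<L , bound
      where
      open ≤-Reasoning
      q′ : ℕ
      q′ = L + q ∸ c
      q′+c≡L+q : q′ + c ≡ L + q
      q′+c≡L+q = m∸n+n≡m (≤-trans c≤L (m≤m+n L q))
      R≡ : R ≡ P * L + q′
      R≡ = +-cancelʳ-≡ c R _ (begin-equality
        R + c            ≡⟨ +-comm R c ⟩
        c + R            ≡⟨ eq ⟩
        L + P * L + q    ≡⟨ xy∙z≈y∙xz L (P * L) q ⟩
        P * L + (L + q)  ≡⟨ cong (P * L +_) q′+c≡L+q ⟨
        P * L + (q′ + c) ≡⟨ +-assoc (P * L) q′ c ⟨
        P * L + q′ + c   ∎)
      q′<L : q′ < L
      q′<L = +-cancelʳ-< c q′ L (begin-strict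
        q′ + c  ≡⟨ q′+c≡L+q ⟩
        L + q   <⟨ +-monoʳ-< L (≰⇒> c≰q) ⟩
        L + c   ∎)
      bound : satellite c + (P * satellite L + remainder q′) ≤ suc P * satellite L + remainder q
      bound = begin
        satellite c + (P * satellite L + remainder q′)  ≡⟨ x∙yz≈y∙zx (satellite c) (P * satellite L) _ ⟩
        P * satellite L + (remainder q′ + satellite c)  ≤⟨ +-monoʳ-≤ (P * satellite L)
                                                             (remainder+satellite≤satellite+remainder
                                                               q′ c q q′+c≡L+q (≰⇒> c≰q) c≤L) ⟩
        P * satellite L + (satellite L + remainder q)   ≡⟨ +-assoc (P * satellite L) _ _ ⟨
        P * satellite L + satellite L + remainder q     ≡⟨ cong (_+ remainder q) (+-comm (P * satellite L) _) ⟩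
        suc P * satellite L + remainder q               ∎

    ∑satellite≤P*satellite+remainder : ∀ {m} (cs : Fin m → ℕ) → (∀ i → 1 ≤ cs i) → (∀ i → cs i ≤ L) →
      ∀ P q → sum cs ≡ P * L + q → q < L → ∑[ i < m ] satellite (cs i) ≤ P * satellite L + remainder q
    ∑satellite≤P*satellite+remainder {zero}  _  _    _    _ _ _ _ = z≤n
    ∑satellite≤P*satellite+remainder {suc m} cs 1≤cs cs≤L P q eq q<L
      with absorb (cs zero) (sum (cs ∘ suc)) P q (1≤cs zero) (cs≤L zero) eq q<L
    ... | P′ , q′ , eq′ , q′<L , absorbed = ≤-trans
      (+-monoʳ-≤ (satellite (cs zero))
        (∑satellite≤P*satellite+remainder (cs ∘ suc) (1≤cs ∘ suc) (cs≤L ∘ suc) P′ q′ eq′ q′<L))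
      absorbed

module _ {n k L j : ℕ} (H : StarLike n k (suc L) (suc (suc j))) where
  open StarLike H using (E; m)
  open StarLikeProperties H
  open Satellites k j

  private
    r : ℕ
    r = suc (suc j)

  numEdges+k≤blocks : k * L ≤ satellite L → ∀ {p q} → n ≡ p * L + q → q < L →
                      numEdges E + k ≤ p * satellite L + remainder q
  numEdges+k≤blocks k*L≤satellite {p} {q} n≡p*L+q q<L = begin
    numEdges E + k
      ≤⟨ +-monoˡ-≤ k (≤-trans numEdges≤ (+-monoʳ-≤ (L C r)
           (∑satellite≤P*satellite+remainder k*L≤satellite order (1≤order (s≤s z≤n))
             (order≤nucleus (≤-trans (s≤s z≤n) q<L)) (p ∸ 1) q (∑order≡[p∸1]*[l∸1]+q {p} n≡p*L+q q<L) q<L))) ⟩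
    L C r + ((p ∸ 1) * satellite L + remainder q) + k
      ≡⟨ nucleus+blocks k (L C r) (p ∸ 1) (remainder q) ⟩
    suc (p ∸ 1) * satellite L + remainder q
      ≡⟨ cong (λ x → x * satellite L + remainder q) (m+[n∸m]≡n (n≡p*[l∸1]+q⇒1≤p {p} n≡p*L+q q<L)) ⟩
    p * satellite L + remainder q ∎
    where
    open ≤-Reasoning
    nucleus+blocks : ∀ k a P x → a + (P * (k + a) + x) + k ≡ suc P * (k + a) + x
    nucleus+blocks = solve-∀

  numEdges≤singletons : ∀ {s} → 1 ≤ L → L ≤ s → LinearWins s → suc L ≤ n →
                        numEdges E ≤ L C r + (n ∸ suc L + 1) * k
  numEdges≤singletons 1≤L L≤s wins l≤n = begin
    numEdges E                             ≤⟨ numEdges≤ ⟩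
    L C r + ∑[ i < m ] satellite (order i) ≤⟨ +-monoʳ-≤ (L C r) (∑satellite≤k*sum order (1≤order (s≤s z≤n))
                                                 (λ i → ≤-trans (order≤nucleus 1≤L i) L≤s) wins) ⟩
    L C r + k * sum order                  ≡⟨ cong (λ x → L C r + k * x) (∑order≡n∸l+1 (s≤s z≤n) l≤n) ⟩
    L C r + k * (n ∸ suc L + 1)            ≡⟨ cong (L C r +_) (*-comm k _) ⟩
    L C r + (n ∸ suc L + 1) * k            ∎
    where open ≤-Reasoning

theorem3p1 : (n k l r t s p q : ℕ) → 2 ≤ k → 2 ≤ r → IsT k r t → IsS k r s →
    l ≤ n → t + 1 ≤ l → n ≡ p * (l ∸ 1) + q → q < l ∸ 1 →
    (H : StarLike n k l r) →
    ((s < l ∸ 1 → s < q → numEdges (StarLike.E H) ≤ p * ((l ∸ 1) C r) + p * k + q C r)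
    × (s < l ∸ 1 → q ≤ s → numEdges (StarLike.E H) ≤ p * ((l ∸ 1) C r) + (p ∸ 1 + q) * k)
    × (l ∸ 1 ≤ s → numEdges (StarLike.E H) ≤ (l ∸ 1) C r + (n ∸ l + 1) * k))
theorem3p1 n k zero    r            t s p q _ _        _ _ _ _ _ () _
theorem3p1 n k (suc L) zero         t s p q _ ()       _ _ _ _ _ _ _
theorem3p1 n k (suc L) (suc zero)   t s p q _ (s≤s ()) _ _ _ _ _ _ _
-- The bound holds without k ≥ 2 and l ≥ t + 1; these only matter for MSH(n;k,l,r) to exist.
theorem3p1 n k (suc L) (suc (suc j)) t s p q _ _ _ (wins , maximal) l≤n _ n≡p*L+q q<L H =
  large-remainder , small-remainder , λ L≤s → numEdges≤singletons H (≤-trans (s≤s z≤n) q<L) L≤s wins l≤n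
  where
  open StarLike H using (E)
  open Satellites k j
  open ≤-Reasoning
  r : ℕ
  r = suc (suc j)
  p≡1+[p∸1] : p ≡ suc (p ∸ 1)
  p≡1+[p∸1] = sym (m+[n∸m]≡n (StarLikeProperties.n≡p*[l∸1]+q⇒1≤p H {p} n≡p*L+q q<L))
  large-remainder : s < L → s < q → numEdges E ≤ p * (L C r) + p * k + q C r
  large-remainder s<L s<q = +-cancelʳ-≤ k _ _ (begin
    numEdges E + k                   ≤⟨ numEdges+k≤blocks H (k*≤satellite-beyond maximal s<L) {p} n≡p*L+q q<L ⟩
    p * satellite L + remainder q    ≤⟨ +-monoʳ-≤ (p * satellite L)
                                          (remainder-lub q (k*≤satellite-beyond maximal s<q) (λ _ → ≤-refl)) ⟩
    p * satellite L + satellite q    ≡⟨ rearrange p k (L C r) (q C r) ⟩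
    p * (L C r) + p * k + q C r + k  ∎)
    where
    rearrange : ∀ p k a b → p * (k + a) + (k + b) ≡ p * a + p * k + b + k
    rearrange = solve-∀
  small-remainder : s < L → q ≤ s → numEdges E ≤ p * (L C r) + (p ∸ 1 + q) * k
  small-remainder s<L q≤s = +-cancelʳ-≤ k _ _ (begin
    numEdges E + k                     ≤⟨ numEdges+k≤blocks H (k*≤satellite-beyond maximal s<L) {p} n≡p*L+q q<L ⟩
    p * satellite L + remainder q      ≤⟨ +-monoʳ-≤ (p * satellite L)
                                            (remainder-lub q ≤-refl (λ 1≤q → linearWins-≤′ 1≤q (≤⇒≤′ q≤s) wins)) ⟩
    p * satellite L + k * q            ≡⟨ cong (λ x → x * satellite L + k * q) p≡1+[p∸1] ⟩
    suc (p ∸ 1) * (k + L C r) + k * q  ≡⟨ rearrange k q (L C r) (p ∸ 1) ⟩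
    suc (p ∸ 1) * (L C r) + (p ∸ 1 + q) * k + k
                                       ≡⟨ cong (λ x → x * (L C r) + (x ∸ 1 + q) * k + k) p≡1+[p∸1] ⟨
    p * (L C r) + (p ∸ 1 + q) * k + k  ∎)
    where
    rearrange : ∀ k q a P → suc P * (k + a) + k * q ≡ suc P * a + (P + q) * k + k
    rearrange = solve-∀
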